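{- Let $M$ be a sharp, integral monoid and $\Gamma$ an $M$-metrised graph. The kernel of the Laplacian $\Delta:\operatorname{PL}(\Gamma)\to\operatorname{Div}(\Gamma)$ is the set of constant functions in $\operatorname{PL}(\Gamma)$.
   Context: Monoids: commutative, sharp (only $0$ invertible), integral (cancellative); $M^{gp}$ groupification. A graph is $(X,r,i)$: $X$ finite, $r$ idempotent, $i$ involution, $i(x)=x\iff r(x)=x$; vertices $V$ = fixed points, half-edges $H=X\setminus V$, $H_v=\{e:r(e)=v\}$; graphs are connected. $M$-metrised: $l:X\to M$, $l\circ i=l$, $l(x)=0\iff x\in V$. $\operatorname{Div}(\Gamma)$ is the free abelian group on $V$. $\operatorname{PL}(\Gamma)=\{g:V\to M^{gp}: g(r(e))-g(r(i(e)))\in\langle l(e)\rangle\ \forall e\in H\}$; $\Delta(g)=\sum_v\sum_{e\in H_v}\frac{g(v)-g(r(i(e)))}{l(e)}[v]$, the quotients being well-defined integers. -}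

module Defs where

open import Level using (Level; _⊔_)
open import Algebra.Bundles using (CommutativeMonoid)
open import Data.Nat using (ℕ; zero; suc)
open import Data.Integer using (ℤ; +_; -[1+_]; 0ℤ) renaming (_+_ to _+ℤ_)
open import Data.Fin using (Fin; zero; suc; _≟_)
open import Data.Product using (Σ; _×_; _,_; proj₁; proj₂; ∃)
open import Relation.Binary.PropositionalEquality using (_≡_)
open import Relation.Nullary using (¬_; yes; no)
open import Function.Bundles using (_⇔_)

record SharpIntegral {c ℓ : Level} (M : CommutativeMonoid c ℓ) : Set (c ⊔ ℓ) where
  open CommutativeMonoid M
  field
    sharp    : ∀ x → (∃ λ y → x ∙ y ≈ ε) → x ≈ ε
    integral : ∀ x y z → x ∙ z ≈ y ∙ z → x ≈ y

-- Groupification M^gp of an integral monoid: formal differences (a , b) = a - b,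
-- with (a , b) ~ (a' , b') iff a + b' = a' + b (the standard relation, which
-- for cancellative monoids is the groupification relation).
module Groupification {c ℓ : Level} (M : CommutativeMonoid c ℓ) where
  open CommutativeMonoid M

  Gp : Set c
  Gp = Carrier × Carrier

  _≈ᵍ_ : Gp → Gp → Set ℓ
  (a , b) ≈ᵍ (a' , b') = (a ∙ b') ≈ (a' ∙ b)

  _-ᵍ_ : Gp → Gp → Gp
  (a , b) -ᵍ (a' , b') = (a ∙ b' , b ∙ a')

  _×ᴹ_ : ℕ → Carrier → Carrier
  zero ×ᴹ x = ε
  suc k ×ᴹ x = x ∙ (k ×ᴹ x)

  _·ᵍ_ : ℤ → Carrier → Gp
  (+ k) ·ᵍ m = (k ×ᴹ m , ε)
  -[1+ k ] ·ᵍ m = (ε , suc k ×ᴹ m)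

Σℤ : (n : ℕ) → (Fin n → ℤ) → ℤ
Σℤ zero f = 0ℤ
Σℤ (suc n) f = f zero +ℤ Σℤ n (λ k → f (suc k))

-- Reachability in the graph (X , r , i) with X = Fin n: a half-edge e links
-- the vertices r e and r (i e).
data Reach {n : ℕ} (r i : Fin n → Fin n) (v : Fin n) : Fin n → Set where
  here : Reach r i v v
  step : ∀ e → ¬ (r e ≡ e) → Reach r i v (r e) → Reach r i v (r (i e))

record Graph : Set where
  field
    size    : ℕ
    r       : Fin size → Fin size
    i       : Fin size → Fin size
    r-idem  : ∀ x → r (r x) ≡ r x
    i-invol : ∀ x → i (i x) ≡ x
    fixed   : ∀ x → (i x ≡ x) ⇔ (r x ≡ x)

  X : Set
  X = Fin size

  IsVertex : X → Set
  IsVertex x = r x ≡ x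

  Vtx : Set
  Vtx = Σ X IsVertex

  IsHalfEdge : X → Set
  IsHalfEdge x = ¬ (r x ≡ x)

  rv : X → Vtx
  rv x = r x , r-idem x

  field
    connected : ∀ (v w : Vtx) → Reach r i (proj₁ v) (proj₁ w)

record Metrisation {c ℓ : Level} (M : CommutativeMonoid c ℓ) (Γ : Graph) : Set (c ⊔ ℓ) where
  open CommutativeMonoid M
  open Graph Γ
  field
    l      : X → Carrier
    l-sym  : ∀ x → l (i x) ≈ l x
    l-zero : ∀ x → (l x ≈ ε) ⇔ IsVertex x

module Laplacian {c ℓ : Level} (M : CommutativeMonoid c ℓ) (Γ : Graph)
                 (L : Metrisation M Γ) where
  open CommutativeMonoid M
  open Groupification M
  open Graph Γ
  open Metrisation L

  Div : Set
  Div = Vtx → ℤ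

  -- g ∈ PL(Γ), with the (unique) integer quotients recorded as a witness q:
  -- g(r e) - g(r(i e)) = q(e) · l(e) for every half-edge e.
  IsPLWith : (Vtx → Gp) → (X → ℤ) → Set ℓ
  IsPLWith g q = ∀ e → IsHalfEdge e → (g (rv e) -ᵍ g (rv (i e))) ≈ᵍ (q e ·ᵍ l e)

  -- Δ(g)(v) = Σ_{e ∈ H_v} (g(v) - g(r(i e))) / l(e) = Σ_{e ∈ H_v} q(e)
  Δ : (X → ℤ) → Div
  Δ q v = Σℤ size (λ x → term x)
    where
      term : X → ℤ
      term x with r x ≟ proj₁ v | r x ≟ x
      ... | yes _ | no _  = q x
      ... | _     | _     = 0ℤ

  IsConstant : (Vtx → Gp) → Set (c ⊔ ℓ)
  IsConstant g = ∃ λ (a : Gp) → ∀ v → g v ≈ᵍ a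

-- Set the slope q to 0 at vertices and write p(e), n(e) for its positive and negative
-- parts, so that g(r e) + n(e) l(e) = g(r i e) + p(e) l(e) in M^gp and, by cancellation
-- and torsion-freeness, p(i e) = n(e).  Multiplying by p(e) and summing over half-edges
-- gives Σ p(e) g(r e) = Σ p(e) g(r i e) + Σ p(e)² l(e).  If Δ = 0, grouping the half-edges
-- by their vertex shows Σ p(e) g(r e) = Σ n(e) g(r e), and the involution i turns the
-- middle sum into the same quantity, so the energy Σ p(e)² l(e) vanishes.  Since M is
-- sharp every term vanishes, hence p = n = 0 on half-edges: g is constant along edges and
-- therefore, Γ being connected, constant.  Conversely a constant g forces q(e) l(e) = 0,
-- hence q = 0 on half-edges and Δ = 0.

module Submission where

open import Defs
open import Level using (Level)
open import Algebra.Bundles using (CommutativeMonoid)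
open import Data.Integer using (ℤ; 0ℤ)
open import Relation.Binary.PropositionalEquality using (_≡_)
open import Function.Bundles using (_⇔_)

open import Algebra.Definitions using (RightCancellative)
open import Algebra.Structures using (IsCommutativeMonoid)
import Algebra.Properties.CommutativeMonoid.Mult as Mult
import Algebra.Properties.CommutativeMonoid.Sum as Sum
import Algebra.Solver.CommutativeMonoid as Solver
open import Axiom.UniquenessOfIdentityProofs using (module Decidable⇒UIP)
open import Data.Bool using (true; false; if_then_else_)
open import Data.Bool.Properties using (if-float)
open import Data.Fin using (Fin; zero; suc; _≟_)
open import Data.Fin.Permutation using (permutation)
open import Data.Integer using (+_; -[1+_])
import Data.Integer as ℤ
import Data.Integer.Properties as ℤ
open import Data.Nat as ℕ using (ℕ; zero; suc)
import Data.Nat.Properties as ℕ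
open import Data.Product using (Σ; ∃; _,_; proj₁; proj₂)
open import Data.Product.Properties using (Σ-≡,≡→≡)
open import Data.Sum using (_⊎_; inj₁; inj₂; [_,_]′)
open import Function using (id; _∘_)
open import Function.Bundles using (mk⇔; Equivalence)
open import Relation.Nullary using (¬_; does; yes; no; contradiction)
import Relation.Binary.PropositionalEquality as ≡

open Sum ℕ.+-0-commutativeMonoid using ()
  renaming (sum to Σℕ; sum-cong-≗ to Σℕ-cong; sum-replicate-zero to Σℕ-zero)

_⁺ _⁻ : ℤ → ℕ
(+ n) ⁺ = n
-[1+ n ] ⁺ = 0
(+ n) ⁻ = 0
-[1+ n ] ⁻ = suc n

⁺≡⁻⇒≡0 : ∀ z → z ⁺ ≡ z ⁻ → z ≡ 0ℤ
⁺≡⁻⇒≡0 (+ n) eq = ≡.cong +_ eq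

-- The hypothesis says z + w = 0.
⁻+⁻≡⁺+⁺⇒⁺≡⁻ : ∀ z w → z ⁻ ℕ.+ w ⁻ ≡ z ⁺ ℕ.+ w ⁺ → w ⁺ ≡ z ⁻
⁻+⁻≡⁺+⁺⇒⁺≡⁻ (+ m) (+ n) eq = ℕ.m+n≡0⇒n≡0 m (≡.sym eq)
⁻+⁻≡⁺+⁺⇒⁺≡⁻ (+ m) -[1+ n ] eq = ≡.refl
⁻+⁻≡⁺+⁺⇒⁺≡⁻ -[1+ m ] (+ n) eq = ≡.trans (≡.sym eq) (ℕ.+-identityʳ (suc m))

Σℤ-cong : ∀ n {f h : Fin n → ℤ} → (∀ x → f x ≡ h x) → Σℤ n f ≡ Σℤ n h
Σℤ-cong zero eq = ≡.refl
Σℤ-cong (suc n) eq = ≡.cong₂ ℤ._+_ (eq zero) (Σℤ-cong n (eq ∘ suc))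

Σℤ-zero : ∀ n {f : Fin n → ℤ} → (∀ x → f x ≡ 0ℤ) → Σℤ n f ≡ 0ℤ
Σℤ-zero zero eq = ≡.refl
Σℤ-zero (suc n) eq = ≡.cong₂ ℤ._+_ (eq zero) (Σℤ-zero n (eq ∘ suc))

Σℤ-split : ∀ n (f : Fin n → ℤ) → + Σℕ (λ x → f x ⁺) ≡ Σℤ n f ℤ.+ + Σℕ (λ x → f x ⁻)
Σℤ-split zero f = ≡.refl
Σℤ-split (suc n) f = begin
  + (a ⁺ ℕ.+ S⁺)
    ≡⟨ ℤ.pos-+ (a ⁺) S⁺ ⟩
  + a ⁺ ℤ.+ + S⁺
    ≡⟨ ≡.cong₂ ℤ._+_ (part a) (Σℤ-split n (f ∘ suc)) ⟩
  (a ℤ.+ + a ⁻) ℤ.+ (Z ℤ.+ + S⁻)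
    ≡⟨ solve 4 (λ a a⁻ z s⁻ → (a ⊕ a⁻) ⊕ (z ⊕ s⁻) ⊜ (a ⊕ z) ⊕ (a⁻ ⊕ s⁻)) ≡.refl a (+ a ⁻) Z (+ S⁻) ⟩
  (a ℤ.+ Z) ℤ.+ (+ a ⁻ ℤ.+ + S⁻)
    ≡⟨ ≡.cong (λ s → (a ℤ.+ Z) ℤ.+ s) (ℤ.pos-+ (a ⁻) S⁻) ⟨
  (a ℤ.+ Z) ℤ.+ + (a ⁻ ℕ.+ S⁻) ∎
  where
  open ≡.≡-Reasoning
  open Solver ℤ.+-0-commutativeMonoid using (solve; _⊕_; _⊜_)
  a Z : ℤ
  a = f zero
  Z = Σℤ n (f ∘ suc)
  S⁺ S⁻ : ℕ
  S⁺ = Σℕ (λ x → f (suc x) ⁺)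
  S⁻ = Σℕ (λ x → f (suc x) ⁻)
  part : ∀ z → + z ⁺ ≡ z ℤ.+ + z ⁻
  part (+ k) = ≡.sym (ℤ.+-identityʳ (+ k))
  part -[1+ k ] = ≡.sym (ℤ.n⊖n≡0 (suc k))

Σℤ≡0⇒Σ⁺≡Σ⁻ : ∀ n (f : Fin n → ℤ) → Σℤ n f ≡ 0ℤ →
              Σℕ (λ x → f x ⁺) ≡ Σℕ (λ x → f x ⁻)
Σℤ≡0⇒Σ⁺≡Σ⁻ n f eq =
  ℤ.+-injective (≡.trans (Σℤ-split n f) (≡.cong (λ s → s ℤ.+ + Σℕ (λ x → f x ⁻)) eq))

fibreSum : ∀ {m n} → (Fin m → Fin n) → (Fin m → ℕ) → Fin n → ℕ
fibreSum φ f y = Σℕ (λ x → if does (φ x ≟ y) then f x else 0)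

module CommutativeMonoidProperties {c ℓ} (N : CommutativeMonoid c ℓ) where
  open CommutativeMonoid N
  open Solver N using (solve; _⊕_; _⊜_)
  open Sum N using (sum; sum-cong-≋; sum-replicate-zero; ∑-distrib-+; ∑-permute)
  open Mult N using (_×_; ×-congʳ; ×-homo-+; ×-distrib-+; ×-assocˡ)
  open import Relation.Binary.Reasoning.Setoid setoid

  sum-pointMass : ∀ {n} (a : Fin n) k (h : Fin n → Carrier) →
                  sum (λ y → (if does (a ≟ y) then k else 0) × h y) ≈ k × h a
  sum-pointMass {suc n} zero k h = trans (∙-congˡ (sum-replicate-zero n)) (identityʳ _)
  sum-pointMass (suc a) k h = trans (identityˡ _) (sum-pointMass a k (h ∘ suc))

  sum-fibres : ∀ {m n} (φ : Fin m → Fin n) (f : Fin m → ℕ) (h : Fin n → Carrier) →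
               sum (λ x → f x × h (φ x)) ≈ sum (λ y → fibreSum φ f y × h y)
  sum-fibres {zero} {n} φ f h = sym (sum-replicate-zero n)
  sum-fibres {suc m} {n} φ f h = begin
    f zero × h (φ zero) ∙ sum (λ x → f (suc x) × h (φ (suc x)))
      ≈⟨ ∙-cong (sym (sum-pointMass (φ zero) (f zero) h)) (sum-fibres (φ ∘ suc) (f ∘ suc) h) ⟩
    sum (λ y → δ y × h y) ∙ sum (λ y → fibreSum (φ ∘ suc) (f ∘ suc) y × h y)
      ≈⟨ ∑-distrib-+ (λ y → δ y × h y) (λ y → fibreSum (φ ∘ suc) (f ∘ suc) y × h y) ⟨
    sum (λ y → δ y × h y ∙ fibreSum (φ ∘ suc) (f ∘ suc) y × h y)
      ≈⟨ sum-cong-≋ (λ y → sym (×-homo-+ (h y) (δ y) _)) ⟩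
    sum (λ y → fibreSum φ f y × h y) ∎
    where
    δ : Fin n → ℕ
    δ y = if does (φ zero ≟ y) then f zero else 0

  sum-involution : ∀ {n} (σ : Fin n → Fin n) → (∀ x → σ (σ x) ≡ x) →
                   (f : Fin n → Carrier) → sum (f ∘ σ) ≈ sum f
  sum-involution σ σσ f = sym (∑-permute f (permutation σ σ σσ σσ))

  -- The hypothesis is a = b + z·c, written without subtraction.
  ⁺-scaled : ∀ z {a b c} → a ∙ z ⁻ × c ≈ b ∙ z ⁺ × c →
             z ⁺ × a ≈ z ⁺ × b ∙ (z ⁺ ℕ.* z ⁺) × c
  ⁺-scaled (+ k) {a} {b} {c} eq = begin
    k × a               ≈⟨ ×-congʳ k (trans (sym (identityʳ a)) eq) ⟩
    k × (b ∙ k × c)     ≈⟨ ×-distrib-+ b (k × c) k ⟩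
    k × b ∙ k × (k × c) ≈⟨ ∙-congˡ (×-assocˡ c k k) ⟩
    k × b ∙ (k ℕ.* k) × c ∎
  ⁺-scaled -[1+ k ] eq = sym (identityˡ ε)

  ∙-cancel-crossed : RightCancellative _≈_ _∙_ → ∀ {a b c c′ d d′} →
                     a ∙ c ≈ b ∙ d → b ∙ c′ ≈ a ∙ d′ → c ∙ c′ ≈ d ∙ d′
  ∙-cancel-crossed cancelʳ {a} {b} {c} {c′} {d} {d′} eq eq′ =
    cancelʳ (a ∙ b) (c ∙ c′) (d ∙ d′) (begin
    (c ∙ c′) ∙ (a ∙ b)
      ≈⟨ solve 4 (λ a b c c′ → (c ⊕ c′) ⊕ (a ⊕ b) ⊜ (a ⊕ c) ⊕ (b ⊕ c′)) refl a b c c′ ⟩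
    (a ∙ c) ∙ (b ∙ c′)
      ≈⟨ ∙-cong eq eq′ ⟩
    (b ∙ d) ∙ (a ∙ d′)
      ≈⟨ solve 4 (λ a b d d′ → (b ⊕ d) ⊕ (a ⊕ d′) ⊜ (d ⊕ d′) ⊕ (a ⊕ b)) refl a b d d′ ⟩
    (d ∙ d′) ∙ (a ∙ b) ∎)

module _ {c ℓ} {M : CommutativeMonoid c ℓ} (SI : SharpIntegral M) where
  open CommutativeMonoid M
  open SharpIntegral SI
  open Sum M using (sum)
  open Mult M using (_×_)

  sum≈ε⇒≈ε : ∀ {n} (f : Fin n → Carrier) → sum f ≈ ε → ∀ j → f j ≈ ε
  sum≈ε⇒≈ε f eq zero = sharp (f zero) (sum (f ∘ suc) , eq)
  sum≈ε⇒≈ε f eq (suc j) = sum≈ε⇒≈ε (f ∘ suc) (sharp _ (f zero , trans (comm _ _) eq)) j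

  ×-cancelʳ : ∀ {x} → ¬ (x ≈ ε) → ∀ m n → m × x ≈ n × x → m ≡ n
  ×-cancelʳ x≉ε zero zero eq = ≡.refl
  ×-cancelʳ {x} x≉ε zero (suc n) eq = contradiction (sharp x (n × x , sym eq)) x≉ε
  ×-cancelʳ {x} x≉ε (suc m) zero eq = contradiction (sharp x (m × x , eq)) x≉ε
  ×-cancelʳ {x} x≉ε (suc m) (suc n) eq =
    ≡.cong suc (×-cancelʳ x≉ε m n (integral _ _ x (trans (comm _ _) (trans eq (comm _ _)))))

module GroupificationMonoid {c ℓ} (M : CommutativeMonoid c ℓ)
         (cancelʳ : RightCancellative (CommutativeMonoid._≈_ M) (CommutativeMonoid._∙_ M)) where
  open CommutativeMonoid M
  open Groupification M
  open Mult M using (_×_)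
  open Sum M using (sum)
  open Solver M using (solve; _⊕_; _⊜_)
  open import Relation.Binary.Reasoning.Setoid setoid

  infixl 7 _∙ᵍ_

  _∙ᵍ_ : Gp → Gp → Gp
  (a , b) ∙ᵍ (c , d) = (a ∙ c , b ∙ d)

  εᵍ : Gp
  εᵍ = (ε , ε)

  ≈ᵍ-refl : ∀ {x} → x ≈ᵍ x
  ≈ᵍ-refl = refl

  ≈ᵍ-sym : ∀ {x y} → x ≈ᵍ y → y ≈ᵍ x
  ≈ᵍ-sym = sym

  ≈ᵍ-trans : ∀ {x y z} → x ≈ᵍ y → y ≈ᵍ z → x ≈ᵍ z
  ≈ᵍ-trans {a , b} {c , d} {e , f} p q = cancelʳ d (a ∙ f) (e ∙ b) (begin
    (a ∙ f) ∙ d ≈⟨ solve 3 (λ a f d → (a ⊕ f) ⊕ d ⊜ (a ⊕ d) ⊕ f) refl a f d ⟩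
    (a ∙ d) ∙ f ≈⟨ ∙-congʳ p ⟩
    (c ∙ b) ∙ f ≈⟨ solve 3 (λ c b f → (c ⊕ b) ⊕ f ⊜ (c ⊕ f) ⊕ b) refl c b f ⟩
    (c ∙ f) ∙ b ≈⟨ ∙-congʳ q ⟩
    (e ∙ d) ∙ b ≈⟨ solve 3 (λ e d b → (e ⊕ d) ⊕ b ⊜ (e ⊕ b) ⊕ d) refl e d b ⟩
    (e ∙ b) ∙ d ∎)

  ∙ᵍ-cong : ∀ {x x′ y y′} → x ≈ᵍ x′ → y ≈ᵍ y′ → (x ∙ᵍ y) ≈ᵍ (x′ ∙ᵍ y′)
  ∙ᵍ-cong {a , b} {a′ , b′} {c , d} {c′ , d′} p q = begin
    (a ∙ c) ∙ (b′ ∙ d′)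
      ≈⟨ solve 4 (λ a c b′ d′ → (a ⊕ c) ⊕ (b′ ⊕ d′) ⊜ (a ⊕ b′) ⊕ (c ⊕ d′)) refl a c b′ d′ ⟩
    (a ∙ b′) ∙ (c ∙ d′)
      ≈⟨ ∙-cong p q ⟩
    (a′ ∙ b) ∙ (c′ ∙ d)
      ≈⟨ solve 4 (λ a′ b c′ d → (a′ ⊕ b) ⊕ (c′ ⊕ d) ⊜ (a′ ⊕ c′) ⊕ (b ⊕ d)) refl a′ b c′ d ⟩
    (a′ ∙ c′) ∙ (b ∙ d)   ∎

  ∙ᵍ-εᵍ-isCommutativeMonoid : IsCommutativeMonoid _≈ᵍ_ _∙ᵍ_ εᵍ
  ∙ᵍ-εᵍ-isCommutativeMonoid = record
    { isMonoid = record
      { isSemigroup = record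
        { isMagma = record
          { isEquivalence = record { refl = ≈ᵍ-refl ; sym = ≈ᵍ-sym ; trans = ≈ᵍ-trans }
          ; ∙-cong = ∙ᵍ-cong
          }
        ; assoc = λ (a , b) (c , d) (e , f) →
            solve 6 (λ a b c d e f → ((a ⊕ c) ⊕ e) ⊕ (b ⊕ (d ⊕ f)) ⊜ (a ⊕ (c ⊕ e)) ⊕ ((b ⊕ d) ⊕ f))
                  refl a b c d e f
        }
      ; identity = (λ (a , b) → ∙-cong (identityˡ a) (sym (identityˡ b)))
                 , (λ (a , b) → ∙-cong (identityʳ a) (sym (identityʳ b)))
      }
    ; comm = λ (a , b) (c , d) → ∙-cong (comm a c) (comm d b)
    }

  ∙ᵍ-εᵍ-commutativeMonoid : CommutativeMonoid c ℓ
  ∙ᵍ-εᵍ-commutativeMonoid = record { isCommutativeMonoid = ∙ᵍ-εᵍ-isCommutativeMonoid }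

  open Mult ∙ᵍ-εᵍ-commutativeMonoid using () renaming (_×_ to _×ᵍ_)
  open Sum ∙ᵍ-εᵍ-commutativeMonoid using () renaming (sum to sumᵍ)

  ∙ᵍ-cancelʳ : RightCancellative _≈ᵍ_ _∙ᵍ_
  ∙ᵍ-cancelʳ (e , f) (a , b) (c , d) eq = cancelʳ (e ∙ f) (a ∙ d) (c ∙ b) (begin
    (a ∙ d) ∙ (e ∙ f)
      ≈⟨ solve 4 (λ a d e f → (a ⊕ d) ⊕ (e ⊕ f) ⊜ (a ⊕ e) ⊕ (d ⊕ f)) refl a d e f ⟩
    (a ∙ e) ∙ (d ∙ f)
      ≈⟨ eq ⟩
    (c ∙ e) ∙ (b ∙ f)
      ≈⟨ solve 4 (λ c b e f → (c ⊕ e) ⊕ (b ⊕ f) ⊜ (c ⊕ b) ⊕ (e ⊕ f)) refl c b e f ⟩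
    (c ∙ b) ∙ (e ∙ f) ∎)

  ι : Carrier → Gp
  ι a = (a , ε)

  ι-cong : ∀ {a b} → a ≈ b → ι a ≈ᵍ ι b
  ι-cong = ∙-congʳ

  ι-injective : ∀ {a b} → ι a ≈ᵍ ι b → a ≈ b
  ι-injective {a} {b} eq = trans (sym (identityʳ a)) (trans eq (identityʳ b))

  ι-∙ : ∀ a b → (ι a ∙ᵍ ι b) ≈ᵍ ι (a ∙ b)
  ι-∙ a b = ∙-congˡ (sym (identityˡ ε))

  ×ᵍ-ι : ∀ k a → (k ×ᵍ ι a) ≈ᵍ ι (k × a)
  ×ᵍ-ι zero a = ≈ᵍ-refl
  ×ᵍ-ι (suc k) a = ≈ᵍ-trans (∙ᵍ-cong ≈ᵍ-refl (×ᵍ-ι k a)) (ι-∙ a (k × a))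

  sumᵍ-ι : ∀ {n} (f : Fin n → Carrier) → sumᵍ (ι ∘ f) ≈ᵍ ι (sum f)
  sumᵍ-ι {zero} f = ≈ᵍ-refl
  sumᵍ-ι {suc n} f = ≈ᵍ-trans (∙ᵍ-cong ≈ᵍ-refl (sumᵍ-ι (f ∘ suc))) (ι-∙ (f zero) (sum (f ∘ suc)))

  ×ᴹ≡× : ∀ k a → k ×ᴹ a ≡ k × a
  ×ᴹ≡× zero a = ≡.refl
  ×ᴹ≡× (suc k) a = ≡.cong (a ∙_) (×ᴹ≡× k a)

  ·ᵍ-split : ∀ z a → (z ·ᵍ a) ≈ᵍ (z ⁺ × a , z ⁻ × a)
  ·ᵍ-split (+ k) a = ∙-congʳ (reflexive (×ᴹ≡× k a))
  ·ᵍ-split -[1+ k ] a = ∙-congˡ (reflexive (≡.sym (×ᴹ≡× (suc k) a)))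

  -ᵍ≈⇒∙ᵍ≈ : ∀ {x y} a b → (x -ᵍ y) ≈ᵍ (a , b) → (x ∙ᵍ ι b) ≈ᵍ (y ∙ᵍ ι a)
  -ᵍ≈⇒∙ᵍ≈ {x₁ , x₂} {y₁ , y₂} a b eq = begin
    (x₁ ∙ b) ∙ (y₂ ∙ ε)
      ≈⟨ solve 4 (λ x₁ y₂ b e → (x₁ ⊕ b) ⊕ (y₂ ⊕ e) ⊜ ((x₁ ⊕ y₂) ⊕ b) ⊕ e) refl x₁ y₂ b ε ⟩
    ((x₁ ∙ y₂) ∙ b) ∙ ε
      ≈⟨ ∙-congʳ eq ⟩
    (a ∙ (x₂ ∙ y₁)) ∙ ε
      ≈⟨ solve 4 (λ a x₂ y₁ e → (a ⊕ (x₂ ⊕ y₁)) ⊕ e ⊜ (y₁ ⊕ a) ⊕ (x₂ ⊕ e)) refl a x₂ y₁ ε ⟩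
    (y₁ ∙ a) ∙ (x₂ ∙ ε)  ∎

  -ᵍ≈·ᵍ⇒∙ᵍ≈ : ∀ {x y} z a → (x -ᵍ y) ≈ᵍ (z ·ᵍ a) → (x ∙ᵍ z ⁻ ×ᵍ ι a) ≈ᵍ (y ∙ᵍ z ⁺ ×ᵍ ι a)
  -ᵍ≈·ᵍ⇒∙ᵍ≈ z a eq =
    ≈ᵍ-trans (∙ᵍ-cong ≈ᵍ-refl (×ᵍ-ι (z ⁻) a))
      (≈ᵍ-trans (-ᵍ≈⇒∙ᵍ≈ (z ⁺ × a) (z ⁻ × a) (≈ᵍ-trans eq (·ᵍ-split z a)))
        (≈ᵍ-sym (∙ᵍ-cong ≈ᵍ-refl (×ᵍ-ι (z ⁺) a))))

  pairwise≈ᵍ⇒constant : ∀ {n} (h : Fin n → Gp) → (∀ x y → h x ≈ᵍ h y) → ∃ λ a → ∀ x → h x ≈ᵍ a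
  pairwise≈ᵍ⇒constant {zero} h _ = εᵍ , λ ()
  pairwise≈ᵍ⇒constant {suc n} h h≈h = h zero , λ x → h≈h x zero

module HarmonicPL {c ℓ} (M : CommutativeMonoid c ℓ) (SI : SharpIntegral M)
                  (Γ : Graph) (L : Metrisation M Γ)
                  (g : Graph.Vtx Γ → Groupification.Gp M) (q : Graph.X Γ → ℤ)
                  (pl : Laplacian.IsPLWith M Γ L g q) where
  open Graph Γ
  open Metrisation L
  open Laplacian M Γ L using (Δ; IsConstant)
  open Groupification M using (Gp)
  open SharpIntegral SI using (integral)
  module 𝕄 = CommutativeMonoid M
  open Mult M using () renaming (_×_ to _×ₘ_)
  open Sum M using () renaming (sum to sumₘ)
  open GroupificationMonoid M (λ x y z → integral y z x)
  open CommutativeMonoid ∙ᵍ-εᵍ-commutativeMonoid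
  open Sum ∙ᵍ-εᵍ-commutativeMonoid using (sum; sum-cong-≋; ∑-distrib-+)
  open Mult ∙ᵍ-εᵍ-commutativeMonoid using (_×_; ×-congʳ; ×-homo-+)
  open CommutativeMonoidProperties ∙ᵍ-εᵍ-commutativeMonoid
  open import Relation.Binary.Reasoning.Setoid setoid

  vertex-or-halfEdge : ∀ x → IsVertex x ⊎ IsHalfEdge x
  vertex-or-halfEdge x with r x ≟ x
  ... | yes v = inj₁ v
  ... | no h = inj₂ h

  i-vertex : ∀ {x} → IsVertex x → i x ≡ x
  i-vertex = Equivalence.from (fixed _)

  l-nonzero : ∀ {x} → IsHalfEdge x → ¬ (l x 𝕄.≈ 𝕄.ε)
  l-nonzero h = h ∘ Equivalence.to (l-zero _)

  rv-vertex : ∀ (v : Vtx) → rv (proj₁ v) ≡ v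
  rv-vertex (x , p) = Σ-≡,≡→≡ (p , Decidable⇒UIP.≡-irrelevant _≟_ _ _)

  G : X → Gp
  G x = g (rv x)

  G-r : ∀ x → G (r x) ≡ G x
  G-r x = ≡.cong g (rv-vertex (rv x))

  lᵍ : X → Gp
  lᵍ x = ι (l x)

  ×lᵍ-cancelʳ : ∀ {x} → IsHalfEdge x → ∀ m n → m × lᵍ x ≈ n × lᵍ x → m ≡ n
  ×lᵍ-cancelʳ {x} h m n eq =
    ×-cancelʳ SI (l-nonzero h) m n (ι-injective (trans (sym (×ᵍ-ι m (l x))) (trans eq (×ᵍ-ι n (l x)))))

  -- q is only constrained on half-edges; the flow forgets its values at vertices.
  flow : X → ℤ
  flow x with r x ≟ x
  ... | yes _ = 0ℤ
  ... | no _ = q x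

  flow-vertex : ∀ {x} → IsVertex x → flow x ≡ 0ℤ
  flow-vertex {x} v with r x ≟ x
  ... | yes _ = ≡.refl
  ... | no h = contradiction v h

  edge-balance : ∀ x → G x ∙ flow x ⁻ × lᵍ x ≈ G (i x) ∙ flow x ⁺ × lᵍ x
  edge-balance x with r x ≟ x
  ... | yes v rewrite i-vertex v = refl
  ... | no h = -ᵍ≈·ᵍ⇒∙ᵍ≈ (q x) (l x) (pl x h)

  edge-balance-i : ∀ x → G (i x) ∙ flow (i x) ⁻ × lᵍ x ≈ G x ∙ flow (i x) ⁺ × lᵍ x
  edge-balance-i x = begin
    G (i x) ∙ flow (i x) ⁻ × lᵍ x
      ≈⟨ ∙-congˡ (×-congʳ (flow (i x) ⁻) (sym lᵍ-i)) ⟩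
    G (i x) ∙ flow (i x) ⁻ × lᵍ (i x)
      ≈⟨ edge-balance (i x) ⟩
    G (i (i x)) ∙ flow (i x) ⁺ × lᵍ (i x)
      ≈⟨ ∙-cong (reflexive (≡.cong G (i-invol x))) (×-congʳ (flow (i x) ⁺) lᵍ-i) ⟩
    G x ∙ flow (i x) ⁺ × lᵍ x           ∎
    where
    lᵍ-i : lᵍ (i x) ≈ lᵍ x
    lᵍ-i = ι-cong (l-sym x)

  flow-antisym : ∀ x → flow (i x) ⁺ ≡ flow x ⁻
  flow-antisym x with vertex-or-halfEdge x
  ... | inj₁ v = ≡.trans (≡.cong (_⁺ ∘ flow) (i-vertex v))
                    (≡.trans (≡.cong _⁺ (flow-vertex v)) (≡.sym (≡.cong _⁻ (flow-vertex v))))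
  ... | inj₂ h = ⁻+⁻≡⁺+⁺⇒⁺≡⁻ (flow x) (flow (i x)) (×lᵍ-cancelʳ h _ _ (begin
    (flow x ⁻ ℕ.+ flow (i x) ⁻) × lᵍ x
      ≈⟨ ×-homo-+ (lᵍ x) (flow x ⁻) (flow (i x) ⁻) ⟩
    flow x ⁻ × lᵍ x ∙ flow (i x) ⁻ × lᵍ x
      ≈⟨ ∙-cancel-crossed ∙ᵍ-cancelʳ (edge-balance x) (edge-balance-i x) ⟩
    flow x ⁺ × lᵍ x ∙ flow (i x) ⁺ × lᵍ x
      ≈⟨ ×-homo-+ (lᵍ x) (flow x ⁺) (flow (i x) ⁺) ⟨
    (flow x ⁺ ℕ.+ flow (i x) ⁺) × lᵍ x        ∎))

  Harmonic : Set
  Harmonic = ∀ v → Δ q v ≡ 0ℤ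

  flowAt : Vtx → X → ℤ
  flowAt v x = if does (r x ≟ proj₁ v) then flow x else 0ℤ

  Δ≡Σflow : ∀ v → Δ q v ≡ Σℤ size (flowAt v)
  Δ≡Σflow v = ≡.trans (proj₂ Δ-as-sum) (Σℤ-cong size summand≡flowAt)
    where
    -- The summand of Δ is local to its where block; unification names it here.
    Δ-as-sum : Σ (X → ℤ) λ F → Δ q v ≡ Σℤ size F
    Δ-as-sum = _ , ≡.refl

    summand≡flowAt : ∀ x → proj₁ Δ-as-sum x ≡ flowAt v x
    summand≡flowAt x with r x ≟ proj₁ v | r x ≟ x
    ... | yes _ | yes _ = ≡.refl
    ... | yes _ | no _ = ≡.refl
    ... | no _ | _ = ≡.refl

  fibre-halfEdge : ∀ {y} → IsHalfEdge y → ∀ f → fibreSum r f y ≡ 0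
  fibre-halfEdge {y} h f = ≡.trans (Σℕ-cong empty) (Σℕ-zero size)
    where
    empty : ∀ x → (if does (r x ≟ y) then f x else 0) ≡ 0
    empty x with r x ≟ y
    ... | yes rx≡y = contradiction (≡.trans (≡.cong r (≡.sym rx≡y)) (≡.trans (r-idem x) rx≡y)) h
    ... | no _ = ≡.refl

  harmonic⇒fibre-balance : Harmonic → ∀ y → fibreSum r (_⁺ ∘ flow) y ≡ fibreSum r (_⁻ ∘ flow) y
  harmonic⇒fibre-balance harm y with vertex-or-halfEdge y
  ... | inj₁ v = ≡.trans (Σℕ-cong (λ x → ≡.sym (if-float _⁺ (does (r x ≟ y)))))
                   (≡.trans (Σℤ≡0⇒Σ⁺≡Σ⁻ size (flowAt (y , v)) Σflow≡0)
                     (Σℕ-cong (λ x → if-float _⁻ (does (r x ≟ y)))))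
    where
    Σflow≡0 : Σℤ size (flowAt (y , v)) ≡ 0ℤ
    Σflow≡0 = ≡.trans (≡.sym (Δ≡Σflow (y , v))) (harm (y , v))
  ... | inj₂ h = ≡.trans (fibre-halfEdge h _) (≡.sym (fibre-halfEdge h _))

  potential-balance : Harmonic → sum (λ x → flow x ⁺ × G x) ≈ sum (λ x → flow x ⁻ × G x)
  potential-balance harm = begin
    sum (λ x → flow x ⁺ × G x)
      ≡⟨ Σ-G-r (_⁺ ∘ flow) ⟨
    sum (λ x → flow x ⁺ × G (r x))
      ≈⟨ sum-fibres r (_⁺ ∘ flow) G ⟩
    sum (λ y → fibreSum r (_⁺ ∘ flow) y × G y)
      ≈⟨ sum-cong-≋ (λ y → reflexive (≡.cong (_× G y) (harmonic⇒fibre-balance harm y))) ⟩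
    sum (λ y → fibreSum r (_⁻ ∘ flow) y × G y)
      ≈⟨ sum-fibres r (_⁻ ∘ flow) G ⟨
    sum (λ x → flow x ⁻ × G (r x))
      ≡⟨ Σ-G-r (_⁻ ∘ flow) ⟩
    sum (λ x → flow x ⁻ × G x)                   ∎
    where
    Σ-G-r : ∀ f → sum (λ x → f x × G (r x)) ≡ sum (λ x → f x × G x)
    Σ-G-r f = Sum.sum-cong-≗ ∙ᵍ-εᵍ-commutativeMonoid (λ x → ≡.cong (f x ×_) (G-r x))

  reflected-balance : sum (λ x → flow x ⁺ × G (i x)) ≈ sum (λ x → flow x ⁻ × G x)
  reflected-balance = begin
    sum (λ x → flow x ⁺ × G (i x))
      ≈⟨ sum-cong-≋ (λ x → reflexive (≡.cong (λ y → flow y ⁺ × G (i x)) (≡.sym (i-invol x)))) ⟩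
    sum (λ x → flow (i (i x)) ⁺ × G (i x))
      ≈⟨ sum-involution i i-invol (λ x → flow (i x) ⁺ × G x) ⟩
    sum (λ x → flow (i x) ⁺ × G x)
      ≈⟨ sum-cong-≋ (λ x → reflexive (≡.cong (_× G x) (flow-antisym x))) ⟩
    sum (λ x → flow x ⁻ × G x)               ∎

  energy : Gp
  energy = sum (λ x → (flow x ⁺ ℕ.* flow x ⁺) × lᵍ x)

  energy-identity : sum (λ x → flow x ⁺ × G x) ≈ sum (λ x → flow x ⁺ × G (i x)) ∙ energy
  energy-identity = trans (sum-cong-≋ (λ x → ⁺-scaled (flow x) (edge-balance x)))
    (∑-distrib-+ (λ x → flow x ⁺ × G (i x)) (λ x → (flow x ⁺ ℕ.* flow x ⁺) × lᵍ x))

  harmonic⇒energy≈ε : Harmonic → energy ≈ ε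
  harmonic⇒energy≈ε harm = ∙ᵍ-cancelʳ T energy ε (begin
    energy ∙ T                                   ≈⟨ comm energy T ⟩
    T ∙ energy                                   ≈⟨ ∙-congʳ reflected-balance ⟨
    sum (λ x → flow x ⁺ × G (i x)) ∙ energy      ≈⟨ energy-identity ⟨
    sum (λ x → flow x ⁺ × G x)                   ≈⟨ potential-balance harm ⟩
    T                                            ≈⟨ identityˡ T ⟨
    ε ∙ T                                        ∎)
    where
    T : Gp
    T = sum (λ x → flow x ⁻ × G x)

  harmonic⇒flow⁺≡0 : Harmonic → ∀ x → flow x ⁺ ≡ 0
  harmonic⇒flow⁺≡0 harm x with vertex-or-halfEdge x
  ... | inj₁ v = ≡.cong _⁺ (flow-vertex v)
  ... | inj₂ h = [ id , id ]′ (ℕ.m*n≡0⇒m≡0∨n≡0 (flow x ⁺)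
                   (×-cancelʳ SI (l-nonzero h) _ 0 (sum≈ε⇒≈ε SI energyₘ energyₘ≈ε x)))
    where
    energyₘ : X → 𝕄.Carrier
    energyₘ y = (flow y ⁺ ℕ.* flow y ⁺) ×ₘ l y

    energyₘ≈ε : sumₘ energyₘ 𝕄.≈ 𝕄.ε
    energyₘ≈ε = ι-injective (begin
      ι (sumₘ energyₘ)
        ≈⟨ sumᵍ-ι energyₘ ⟨
      sum (ι ∘ energyₘ)
        ≈⟨ sum-cong-≋ (λ y → sym (×ᵍ-ι (flow y ⁺ ℕ.* flow y ⁺) (l y))) ⟩
      energy
        ≈⟨ harmonic⇒energy≈ε harm ⟩
      ε ∎)

  harmonic⇒flow≡0 : Harmonic → ∀ x → flow x ≡ 0ℤ
  harmonic⇒flow≡0 harm x =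
    ⁺≡⁻⇒≡0 (flow x) (≡.trans (flow⁺≡0 x) (≡.trans (≡.sym (flow⁺≡0 (i x))) (flow-antisym x)))
    where
    flow⁺≡0 : ∀ y → flow y ⁺ ≡ 0
    flow⁺≡0 = harmonic⇒flow⁺≡0 harm

  zero-flow⇒G≈G∘i : (∀ x → flow x ≡ 0ℤ) → ∀ x → G x ≈ G (i x)
  zero-flow⇒G≈G∘i zero-flow x = begin
    G x                       ≈⟨ identityʳ (G x) ⟨
    G x ∙ ε                   ≡⟨ ≡.cong (λ z → G x ∙ z ⁻ × lᵍ x) (zero-flow x) ⟨
    G x ∙ flow x ⁻ × lᵍ x     ≈⟨ edge-balance x ⟩
    G (i x) ∙ flow x ⁺ × lᵍ x ≡⟨ ≡.cong (λ z → G (i x) ∙ z ⁺ × lᵍ x) (zero-flow x) ⟩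
    G (i x) ∙ ε               ≈⟨ identityʳ (G (i x)) ⟩
    G (i x)                   ∎

  reachable⇒≈ : (∀ x → G x ≈ G (i x)) → ∀ {v w} → Reach r i v w → G w ≈ G v
  reachable⇒≈ G≈G∘i here = refl
  reachable⇒≈ G≈G∘i {v} (step e _ reach) = begin
    G (r (i e)) ≡⟨ G-r (i e) ⟩
    G (i e)     ≈⟨ G≈G∘i e ⟨
    G e         ≡⟨ G-r e ⟨
    G (r e)     ≈⟨ reachable⇒≈ G≈G∘i reach ⟩
    G v         ∎

  harmonic⇒constant : Harmonic → IsConstant g
  harmonic⇒constant harm = a , λ v → ≡.subst (_≈ a) (≡.cong g (rv-vertex v)) (G≈a (proj₁ v))
    where
    G≈G∘i : ∀ x → G x ≈ G (i x)
    G≈G∘i = zero-flow⇒G≈G∘i (harmonic⇒flow≡0 harm)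

    G≈G : ∀ x y → G x ≈ G y
    G≈G x y = begin
      G x     ≡⟨ G-r x ⟨
      G (r x) ≈⟨ reachable⇒≈ G≈G∘i (connected (rv y) (rv x)) ⟩
      G (r y) ≡⟨ G-r y ⟩
      G y     ∎

    a : Gp
    a = proj₁ (pairwise≈ᵍ⇒constant G G≈G)

    G≈a : ∀ x → G x ≈ a
    G≈a = proj₂ (pairwise≈ᵍ⇒constant G G≈G)

  constant⇒flow≡0 : IsConstant g → ∀ x → flow x ≡ 0ℤ
  constant⇒flow≡0 (a , g≈a) x with vertex-or-halfEdge x
  ... | inj₁ v = flow-vertex v
  ... | inj₂ h = ⁺≡⁻⇒≡0 (flow x) (≡.sym (×lᵍ-cancelʳ h _ _ (∙ᵍ-cancelʳ (G x) _ _ (begin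
    flow x ⁻ × lᵍ x ∙ G x   ≈⟨ comm _ _ ⟩
    G x ∙ flow x ⁻ × lᵍ x   ≈⟨ edge-balance x ⟩
    G (i x) ∙ flow x ⁺ × lᵍ x ≈⟨ ∙-congʳ (trans (g≈a (rv (i x))) (sym (g≈a (rv x)))) ⟩
    G x ∙ flow x ⁺ × lᵍ x   ≈⟨ comm _ _ ⟩
    flow x ⁺ × lᵍ x ∙ G x   ∎))))

  constant⇒harmonic : IsConstant g → Harmonic
  constant⇒harmonic const v = ≡.trans (Δ≡Σflow v) (Σℤ-zero size flowAt≡0)
    where
    flowAt≡0 : ∀ x → flowAt v x ≡ 0ℤ
    flowAt≡0 x with does (r x ≟ proj₁ v)
    ... | true = constant⇒flow≡0 const x
    ... | false = ≡.refl

lemma2p8 : ∀ {c ℓ : Level} (M : CommutativeMonoid c ℓ) → SharpIntegral M →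
    (Γ : Graph) (L : Metrisation M Γ) →
    let open Laplacian M Γ L
        open Graph Γ
        open Groupification M
    in ∀ (g : Vtx → Gp) (q : X → ℤ) → IsPLWith g q →
       ((∀ v → Δ q v ≡ 0ℤ) ⇔ IsConstant g)
lemma2p8 M SI Γ L g q pl = mk⇔ harmonic⇒constant constant⇒harmonic
  where open HarmonicPL M SI Γ L g q pl
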